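{- Let $\mathcal{C}$ be a target–context category with intrinsic behaviors in which $\mathrm{eval}\colon T\otimes C\to B$ is an $A$-complete parametrization of maps $C\to B$ (for some object $A$). If there exists a universal simulator $s\colon C\otimes C\to T\otimes C$ (i.e. with object of programs $C$), then every morphism $g\colon B\to B$ has a quasi-fixed point, i.e. a morphism $b$ with codomain $B$ such that $\overline b\succeq^{\rm im}\overline g\circ\overline b$.
   Context: $\mathcal{C}$ is a gs-monoidal category (symmetric monoidal with tensor $\otimes$, unit $I$, commutative comonoids $\mathrm{copy}_A\colon A\to A\otimes A$, $\mathrm{del}_A\colon A\to I$ compatible with $\otimes$, $\mathrm{del}_I=\mathrm{id}_I$), all of whose morphisms are normalized ($f\circ\mathrm{dom}(f)=f$, $\mathrm{dom}(f)=(\mathrm{id}_A\otimes(\mathrm{del}_X\circ f))\circ\mathrm{copy}_A$). $f$ is functional if $\mathrm{copy}_X\circ f=(f\otimes f)\circ\mathrm{copy}_A$. A lax gs-monoidal functor $\Phi\colon\mathcal{C}\to\mathbf{Rel}$ (sets and relations with cartesian product) is a lax symmetric monoidal functor whose structure maps $\psi_0,\psi_{A,B}$ satisfy $\Phi(\mathrm{copy}_A)=\psi_{A,A}\circ\mathrm{copy}_{\Phi A}$, $\Phi(\mathrm{del}_A)=\psi_0\circ\mathrm{del}_{\Phi A}$; $\overline X=\Phi(X)$, $\overline f=\Phi(f)$. Imitation: for a preordered set $(X,\succeq)$ and relations $\nu,\mu\colon A\to X$, $\nu\succeq^{\rm im}\mu$ iff for every $a$ with $\mu(a)\ne\emptyset$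 there are functions $\mathrm{enh}\colon\mu(a)\to\nu(a)$ with $\mathrm{enh}(u)\succeq u$ and $\mathrm{deg}\colon\nu(a)\to\mu(a)$ with $v\succeq\mathrm{deg}(v)$. A target–context category with intrinsic behaviors: such $\mathcal{C}$ with objects $T,C,B$, a morphism $\mathrm{eval}\colon T\otimes C\to B$ with $\overline{\mathrm{eval}}$ a function, a lax gs-monoidal $\Phi$, a preorder $\succeq$ on $\overline B$; the ambient relation on $\mathcal{C}(A,T\otimes C)$ is $f\succeq g$ iff $\overline{\mathrm{eval}}\circ\overline f\succeq^{\rm im}\overline{\mathrm{eval}}\circ\overline g$, required to satisfy $f\circ\mathrm{dom}(g)=g\Rightarrow f\succeq g$ and $f\succeq g\Rightarrow f\circ h\succeq g\circ h$. A simulator with programs $P$ is $s\colon P\otimes C\to T\otimes C$ for which there are a functional $s_T\colon P\to T$ and $s_C\colon P\otimes C\to C$ with $s=(s_T\otimes s_C)\circ(\mathrm{copy}_P\otimes\mathrm{id}_C)$, $(\mathrm{id}_T\otimes\mathrm{del}_C)\circ s=s_T\otimes\mathrm{del}_C$, $(\mathrm{del}_T\otimes\mathrm{id}_C)\circ s=s_C$. It is universal if there is a functional $r\colon T\to P$ with $s\circ(r\otimes\mathrm{id}_C)\succeq\mathrm{id}_{T\otimes C}$. $F\colon P\otimes C\to B$ is an $A$-complete parametrization of maps $C\to B$ if for every $f\colon A\otimes C\to B$ there is a functional $p_f\colon A\to P$ with $\overline{F\circ(p_f\otimes\mathrm{id}_C)}\succeq^{\rm im}\overline f$. -}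

module Defs where

open import Level using (Level; _⊔_) renaming (suc to lsuc)
open import Data.Product using (Σ; Σ-syntax; ∃; _×_; _,_; proj₁; proj₂; swap)
open import Data.Unit.Polymorphic using (⊤; tt)
open import Relation.Binary.PropositionalEquality using (_≡_)
open import Relation.Binary.Structures using (IsPreorder)

module _ {p : Level} where

  RelP : Set p → Set p → Set (lsuc p)
  RelP X Y = X → Y → Set p

  _≐_ : ∀ {X Y} → RelP X Y → RelP X Y → Set p
  R ≐ S = ∀ x y → (R x y → S x y) × (S x y → R x y)

  idR : ∀ {X} → RelP X X
  idR x y = x ≡ y

  infixr 9 _∘R_
  _∘R_ : ∀ {X Y Z} → RelP Y Z → RelP X Y → RelP X Z
  (S ∘R R) x z = Σ[ y ∈ _ ] (R x y × S y z)

  infixr 10 _×R_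
  _×R_ : ∀ {X Y X′ Y′} → RelP X Y → RelP X′ Y′ → RelP (X × X′) (Y × Y′)
  (R ×R S) (x , x′) (y , y′) = R x y × S x′ y′

  graph : ∀ {X Y} → (X → Y) → RelP X Y
  graph f x y = f x ≡ y

  αR : ∀ {X Y Z : Set p} → RelP ((X × Y) × Z) (X × (Y × Z))
  αR = graph (λ { ((x , y) , z) → x , (y , z) })

  λR : ∀ {X} → RelP (⊤ {p} × X) X
  λR = graph proj₂

  ρR : ∀ {X} → RelP (X × ⊤ {p}) X
  ρR = graph proj₁

  σR : ∀ {X Y : Set p} → RelP (X × Y) (Y × X)
  σR = graph swap

  copyR : ∀ {X : Set p} → RelP X (X × X)
  copyR = graph (λ x → x , x)

  delR : ∀ {X} → RelP X (⊤ {p})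
  delR = graph (λ _ → tt)

  IsFunctionR : ∀ {X Y} → RelP X Y → Set p
  IsFunctionR {X} {Y} R =
    ((x : X) → Σ[ y ∈ Y ] R x y) × (∀ {x y y′} → R x y → R x y′ → y ≡ y′)

  Imitates : ∀ {A X} → RelP X X → RelP A X → RelP A X → Set p
  Imitates {A} {X} _⪰_ ν μ =
    (a : A) → Σ[ u ∈ X ] μ a u →
      (Σ[ enh ∈ (Σ[ u ∈ X ] μ a u → Σ[ v ∈ X ] ν a v) ]
         (∀ u → proj₁ (enh u) ⪰ proj₁ u))
    × (Σ[ deg ∈ (Σ[ v ∈ X ] ν a v → Σ[ u ∈ X ] μ a u) ]
         (∀ v → proj₁ v ⪰ proj₁ (deg v)))

record GSMonCat (o ℓ : Level) : Set (lsuc (o ⊔ ℓ)) where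
  infixr 9 _∘_
  infixr 10 _⊗₀_ _⊗₁_
  field
    Obj : Set o
    Hom : Obj → Obj → Set ℓ
    id  : ∀ {A} → Hom A A
    _∘_ : ∀ {A B D} → Hom B D → Hom A B → Hom A D
    identityˡ : ∀ {A B} {f : Hom A B} → id ∘ f ≡ f
    identityʳ : ∀ {A B} {f : Hom A B} → f ∘ id ≡ f
    assoc : ∀ {A B D E} {f : Hom A B} {g : Hom B D} {h : Hom D E} →
            (h ∘ g) ∘ f ≡ h ∘ (g ∘ f)
    _⊗₀_ : Obj → Obj → Obj
    _⊗₁_ : ∀ {A B A′ B′} → Hom A B → Hom A′ B′ → Hom (A ⊗₀ A′) (B ⊗₀ B′)
    ⊗-id : ∀ {A B} → id {A} ⊗₁ id {B} ≡ id
    ⊗-∘  : ∀ {A B D A′ B′ D′} {f : Hom A B} {f′ : Hom B D}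
             {g : Hom A′ B′} {g′ : Hom B′ D′} →
           (f′ ∘ f) ⊗₁ (g′ ∘ g) ≡ (f′ ⊗₁ g′) ∘ (f ⊗₁ g)
    unit : Obj
    α⇒ : ∀ {A B D} → Hom ((A ⊗₀ B) ⊗₀ D) (A ⊗₀ (B ⊗₀ D))
    α⇐ : ∀ {A B D} → Hom (A ⊗₀ (B ⊗₀ D)) ((A ⊗₀ B) ⊗₀ D)
    α-isoˡ : ∀ {A B D} → α⇐ {A} {B} {D} ∘ α⇒ ≡ id
    α-isoʳ : ∀ {A B D} → α⇒ {A} {B} {D} ∘ α⇐ ≡ id
    α-natural : ∀ {A B D A′ B′ D′} {f : Hom A A′} {g : Hom B B′} {h : Hom D D′} →
                α⇒ ∘ ((f ⊗₁ g) ⊗₁ h) ≡ (f ⊗₁ (g ⊗₁ h)) ∘ α⇒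
    λ⇒ : ∀ {A} → Hom (unit ⊗₀ A) A
    λ⇐ : ∀ {A} → Hom A (unit ⊗₀ A)
    λ-isoˡ : ∀ {A} → λ⇐ {A} ∘ λ⇒ ≡ id
    λ-isoʳ : ∀ {A} → λ⇒ {A} ∘ λ⇐ ≡ id
    λ-natural : ∀ {A B} {f : Hom A B} → λ⇒ ∘ (id ⊗₁ f) ≡ f ∘ λ⇒
    ρ⇒ : ∀ {A} → Hom (A ⊗₀ unit) A
    ρ⇐ : ∀ {A} → Hom A (A ⊗₀ unit)
    ρ-isoˡ : ∀ {A} → ρ⇐ {A} ∘ ρ⇒ ≡ id
    ρ-isoʳ : ∀ {A} → ρ⇒ {A} ∘ ρ⇐ ≡ id
    ρ-natural : ∀ {A B} {f : Hom A B} → ρ⇒ ∘ (f ⊗₁ id) ≡ f ∘ ρ⇒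
    σ : ∀ {A B} → Hom (A ⊗₀ B) (B ⊗₀ A)
    σ-involutive : ∀ {A B} → σ {B} {A} ∘ σ {A} {B} ≡ id
    σ-natural : ∀ {A B A′ B′} {f : Hom A A′} {g : Hom B B′} →
                σ ∘ (f ⊗₁ g) ≡ (g ⊗₁ f) ∘ σ
    pentagon : ∀ {A B D E} →
      (id {A} ⊗₁ α⇒ {B} {D} {E}) ∘ α⇒ ∘ (α⇒ ⊗₁ id) ≡ α⇒ ∘ α⇒
    triangle : ∀ {A B} → (id {A} ⊗₁ λ⇒ {B}) ∘ α⇒ ≡ ρ⇒ ⊗₁ id
    hexagon : ∀ {A B D} →
      α⇒ {B} {D} {A} ∘ σ ∘ α⇒ ≡ (id ⊗₁ σ) ∘ α⇒ ∘ (σ ⊗₁ id)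
    copy : ∀ {A} → Hom A (A ⊗₀ A)
    del  : ∀ {A} → Hom A unit
    copy-coassoc : ∀ {A} → α⇒ ∘ (copy ⊗₁ id) ∘ copy {A} ≡ (id ⊗₁ copy) ∘ copy
    copy-counitˡ : ∀ {A} → λ⇒ ∘ (del ⊗₁ id) ∘ copy {A} ≡ id
    copy-counitʳ : ∀ {A} → ρ⇒ ∘ (id ⊗₁ del) ∘ copy {A} ≡ id
    copy-comm : ∀ {A} → σ ∘ copy {A} ≡ copy
    copy-⊗ : ∀ {A B} →
      copy {A ⊗₀ B} ≡ (α⇐ ∘ (id ⊗₁ (α⇒ ∘ (σ ⊗₁ id) ∘ α⇐)) ∘ α⇒) ∘ (copy ⊗₁ copy)
    del-⊗ : ∀ {A B} → del {A ⊗₀ B} ≡ λ⇒ ∘ (del ⊗₁ del)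
    copy-unit : copy {unit} ≡ λ⇐
    del-unit : del {unit} ≡ id

  dom : ∀ {A X} → Hom A X → Hom A A
  dom f = ρ⇒ ∘ (id ⊗₁ (del ∘ f)) ∘ copy

  Normalized : ∀ {A X} → Hom A X → Set ℓ
  Normalized f = f ∘ dom f ≡ f

  Functional : ∀ {A X} → Hom A X → Set ℓ
  Functional f = copy ∘ f ≡ (f ⊗₁ f) ∘ copy

record LaxGSFunctor {o ℓ} (𝒞 : GSMonCat o ℓ) (p : Level)
       : Set (o ⊔ ℓ ⊔ lsuc p) where
  open GSMonCat 𝒞
  field
    F₀ : Obj → Set p
    F₁ : ∀ {A B} → Hom A B → RelP (F₀ A) (F₀ B)
    F-id : ∀ {A} → F₁ (id {A}) ≐ idR
    F-∘  : ∀ {A B D} {f : Hom A B} {g : Hom B D} → F₁ (g ∘ f) ≐ (F₁ g ∘R F₁ f)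
    ψ₀ : RelP (⊤ {p}) (F₀ unit)
    ψ  : ∀ {A B} → RelP (F₀ A × F₀ B) (F₀ (A ⊗₀ B))
    ψ-natural : ∀ {A B A′ B′} {f : Hom A A′} {g : Hom B B′} →
                (F₁ (f ⊗₁ g) ∘R ψ) ≐ (ψ ∘R (F₁ f ×R F₁ g))
    ψ-assoc : ∀ {A B D} →
      (F₁ (α⇒ {A} {B} {D}) ∘R ψ ∘R (ψ ×R idR)) ≐ (ψ ∘R (idR ×R ψ) ∘R αR)
    ψ-unitˡ : ∀ {A} → (F₁ (λ⇒ {A}) ∘R ψ ∘R (ψ₀ ×R idR)) ≐ λR
    ψ-unitʳ : ∀ {A} → (F₁ (ρ⇒ {A}) ∘R ψ ∘R (idR ×R ψ₀)) ≐ ρR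
    ψ-sym : ∀ {A B} → (F₁ (σ {A} {B}) ∘R ψ) ≐ (ψ ∘R σR)
    F-copy : ∀ {A} → F₁ (copy {A}) ≐ (ψ ∘R copyR)
    F-del  : ∀ {A} → F₁ (del {A}) ≐ (ψ₀ ∘R delR)

record TCCat (o ℓ p : Level) : Set (lsuc (o ⊔ ℓ ⊔ p)) where
  field
    𝒞 : GSMonCat o ℓ
  open GSMonCat 𝒞 public
  field
    normalized : ∀ {A X} (f : Hom A X) → Normalized f
    T C B : Obj
    eval : Hom (T ⊗₀ C) B
    Φ : LaxGSFunctor 𝒞 p
  open LaxGSFunctor Φ public
  field
    eval-function : IsFunctionR (F₁ eval)
    _⪰B_ : RelP (F₀ B) (F₀ B)
    ⪰B-preorder : IsPreorder _≡_ _⪰B_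

  _⪰_ : ∀ {A} → Hom A (T ⊗₀ C) → Hom A (T ⊗₀ C) → Set p
  f ⪰ g = Imitates _⪰B_ (F₁ eval ∘R F₁ f) (F₁ eval ∘R F₁ g)

  field
    ⪰-dom : ∀ {A} {f g : Hom A (T ⊗₀ C)} → f ∘ dom g ≡ g → f ⪰ g
    ⪰-precomp : ∀ {A A′} {f g : Hom A (T ⊗₀ C)} (h : Hom A′ A) →
                f ⪰ g → (f ∘ h) ⪰ (g ∘ h)

  IsSimulator : ∀ {P} → Hom (P ⊗₀ C) (T ⊗₀ C) → Set ℓ
  IsSimulator {P} s =
    Σ[ sT ∈ Hom P T ] Σ[ sC ∈ Hom (P ⊗₀ C) C ]
      ( Functional sT
      × s ≡ (sT ⊗₁ sC) ∘ α⇒ ∘ (copy ⊗₁ id)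
      × (id ⊗₁ del) ∘ s ≡ sT ⊗₁ del
      × λ⇒ ∘ (del ⊗₁ id) ∘ s ≡ sC )

  IsUniversalSimulator : ∀ {P} → Hom (P ⊗₀ C) (T ⊗₀ C) → Set (ℓ ⊔ p)
  IsUniversalSimulator {P} s =
    IsSimulator s × (Σ[ r ∈ Hom T P ] (Functional r × ((s ∘ (r ⊗₁ id)) ⪰ id)))

  IsCompleteParametrization : ∀ {P} (A : Obj) → Hom (P ⊗₀ C) B → Set (ℓ ⊔ p)
  IsCompleteParametrization {P} A F =
    (f : Hom (A ⊗₀ C) B) →
      Σ[ pf ∈ Hom A P ] (Functional pf × Imitates _⪰B_ (F₁ (F ∘ (pf ⊗₁ id))) (F₁ f))

  QuasiFixedPoint : ∀ {X} → Hom B B → Hom X B → Set p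
  QuasiFixedPoint g b = Imitates _⪰B_ (F₁ b) (F₁ g ∘R F₁ b)

-- A diagonal argument in the style of Lawvere's fixed-point theorem.
-- Completeness applied to the self-application map d (a , c) = g (eval (s (c , c)))
-- yields a functional program p : A → T with eval ∘ (p ⊗ id) imitating d.  With
-- r the retraction witnessing universality of s, q = r ∘ p : A → C is a code of p,
-- and b = eval ∘ s ∘ copy ∘ q runs the simulator on that code against itself.
-- Universality of s gives b ⪰ eval ∘ (p ⊗ id) ∘ ⟨ id , q ⟩, and completeness
-- pulled back along ⟨ id , q ⟩ gives eval ∘ (p ⊗ id) ∘ ⟨ id , q ⟩ ⪰ d ∘ ⟨ id , q ⟩ = g ∘ b.
-- Pulling an imitation back along a morphism needs its image under Φ to be
-- single-valued; this holds for functional morphisms because ψ is injective,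
-- its two components being recovered by the (total) images of the projections.

module Submission where

open import Defs
open import Level using (Level)
open import Data.Product using (Σ; Σ-syntax; _×_; _,_; proj₁; proj₂; map₂)
open import Data.Unit.Polymorphic using (tt)
open import Relation.Binary.Definitions using (Transitive)
open import Relation.Binary.PropositionalEquality
  using (_≡_; refl; sym; trans; cong; cong₂; subst; module ≡-Reasoning)
open import Relation.Binary.Structures using (IsPreorder)

module _ {p : Level} {X Y : Set p} where

  ≐-refl : {R : RelP X Y} → R ≐ R
  ≐-refl x y = (λ r → r) , (λ r → r)

  ≐-sym : {R S : RelP X Y} → R ≐ S → S ≐ R
  ≐-sym e x y = proj₂ (e x y) , proj₁ (e x y)

  ≐-trans : {R S U : RelP X Y} → R ≐ S → S ≐ U → R ≐ U
  ≐-trans e e′ x y = (λ r → proj₁ (e′ x y) (proj₁ (e x y) r)) , (λ u → proj₂ (e x y) (proj₂ (e′ x y) u))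

  ≐⇒ : {R S : RelP X Y} → R ≐ S → ∀ {x y} → R x y → S x y
  ≐⇒ e = proj₁ (e _ _)

  ≐⇐ : {R S : RelP X Y} → R ≐ S → ∀ {x y} → S x y → R x y
  ≐⇐ e = proj₂ (e _ _)

  Total : RelP X Y → Set p
  Total R = ∀ x → Σ[ y ∈ Y ] R x y

  SingleValued : RelP X Y → Set p
  SingleValued R = ∀ {x y y′} → R x y → R x y′ → y ≡ y′

module ImitationProperties {p : Level} {X : Set p} (_⪰_ : RelP X X) (⪰-trans : Transitive _⪰_) where

  Imitates-trans : ∀ {A} {ν μ κ : RelP A X} → Imitates _⪰_ ν μ → Imitates _⪰_ μ κ → Imitates _⪰_ ν κ
  Imitates-trans ν⪰μ μ⪰κ a κa with μ⪰κ a κa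
  ... | (enh₂ , enh₂⪰) , (deg₂ , deg₂⪰) with ν⪰μ a (enh₂ κa)
  ... | (enh₁ , enh₁⪰) , (deg₁ , deg₁⪰) =
    ((λ u → enh₁ (enh₂ u)) , λ u → ⪰-trans (enh₁⪰ (enh₂ u)) (enh₂⪰ u)) ,
    ((λ v → deg₂ (deg₁ v)) , λ v → ⪰-trans (deg₁⪰ v) (deg₂⪰ (deg₁ v)))

  Imitates-resp-≐ : ∀ {A} {ν ν′ μ μ′ : RelP A X} → ν ≐ ν′ → μ ≐ μ′ →
                    Imitates _⪰_ ν μ → Imitates _⪰_ ν′ μ′
  Imitates-resp-≐ ν≐ν′ μ≐μ′ ν⪰μ a μ′a with ν⪰μ a (map₂ (≐⇐ μ≐μ′) μ′a)
  ... | (enh , enh⪰) , (deg , deg⪰) =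
    ((λ u → map₂ (≐⇒ ν≐ν′) (enh (map₂ (≐⇐ μ≐μ′) u))) , λ u → enh⪰ (map₂ (≐⇐ μ≐μ′) u)) ,
    ((λ v → map₂ (≐⇒ μ≐μ′) (deg (map₂ (≐⇐ ν≐ν′) v))) , λ v → deg⪰ (map₂ (≐⇐ ν≐ν′) v))

  -- Single-valuedness of R is what makes μ nonempty at every R-image of x,
  -- which the degradation map needs.
  Imitates-∘R : ∀ {A A′} {ν μ : RelP A X} {R : RelP A′ A} → SingleValued R →
                Imitates _⪰_ ν μ → Imitates _⪰_ (ν ∘R R) (μ ∘R R)
  Imitates-∘R {ν = ν} {μ} {R} R-sv ν⪰μ x (u , a , Rxa , μau) = (enh , enh⪰) , (deg , deg⪰)
    where
    μ-nonempty : ∀ {a′} → R x a′ → Σ _ (μ a′)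
    μ-nonempty Rxa′ = u , subst (λ a′ → μ a′ u) (R-sv Rxa Rxa′) μau

    enh : Σ _ ((μ ∘R R) x) → Σ _ ((ν ∘R R) x)
    enh (u′ , a′ , Rxa′ , μa′u′) =
      map₂ (λ νa′v → a′ , Rxa′ , νa′v) (proj₁ (proj₁ (ν⪰μ a′ (u′ , μa′u′))) (u′ , μa′u′))

    enh⪰ : ∀ w → proj₁ (enh w) ⪰ proj₁ w
    enh⪰ (u′ , a′ , _ , μa′u′) = proj₂ (proj₁ (ν⪰μ a′ (u′ , μa′u′))) (u′ , μa′u′)

    deg : Σ _ ((ν ∘R R) x) → Σ _ ((μ ∘R R) x)
    deg (v , a′ , Rxa′ , νa′v) =
      map₂ (λ μa′u′ → a′ , Rxa′ , μa′u′) (proj₁ (proj₂ (ν⪰μ a′ (μ-nonempty Rxa′))) (v , νa′v))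

    deg⪰ : ∀ w → proj₁ w ⪰ proj₁ (deg w)
    deg⪰ (v , a′ , Rxa′ , νa′v) = proj₂ (proj₂ (ν⪰μ a′ (μ-nonempty Rxa′))) (v , νa′v)

module GSMonoidalProperties {o ℓ : Level} (𝒞 : GSMonCat o ℓ) where
  open GSMonCat 𝒞
  open ≡-Reasoning

  private variable
    V W X Y Z W′ X′ Y′ Z′ : Obj

  pullˡ : {f : Hom X Y} {g : Hom Y Z} {h : Hom X Z} {k : Hom W X} →
          g ∘ f ≡ h → g ∘ f ∘ k ≡ h ∘ k
  pullˡ e = trans (sym assoc) (cong (_∘ _) e)

  extendʳ : {f : Hom X Y} {g : Hom Y Z} {f′ : Hom X V} {g′ : Hom V Z} {k : Hom W X} →
            g ∘ f ≡ g′ ∘ f′ → g ∘ f ∘ k ≡ g′ ∘ f′ ∘ k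
  extendʳ e = trans (sym assoc) (trans (cong (_∘ _) e) assoc)

  serialize₁₂ : {f : Hom X X′} {g : Hom Y Y′} → f ⊗₁ g ≡ (f ⊗₁ id) ∘ (id ⊗₁ g)
  serialize₁₂ = trans (cong₂ _⊗₁_ (sym identityʳ) (sym identityˡ)) ⊗-∘

  serialize₂₁ : {f : Hom X X′} {g : Hom Y Y′} → f ⊗₁ g ≡ (id ⊗₁ g) ∘ (f ⊗₁ id)
  serialize₂₁ = trans (cong₂ _⊗₁_ (sym identityˡ) (sym identityʳ)) ⊗-∘

  α⇐-natural : {f : Hom X X′} {g : Hom Y Y′} {h : Hom Z Z′} →
               α⇐ ∘ (f ⊗₁ (g ⊗₁ h)) ≡ ((f ⊗₁ g) ⊗₁ h) ∘ α⇐
  α⇐-natural {f = f} {g} {h} = begin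
    α⇐ ∘ (f ⊗₁ (g ⊗₁ h))                  ≡⟨ cong (α⇐ ∘_) (sym identityʳ) ⟩
    α⇐ ∘ (f ⊗₁ (g ⊗₁ h)) ∘ id             ≡⟨ cong (λ k → α⇐ ∘ (f ⊗₁ (g ⊗₁ h)) ∘ k) (sym α-isoʳ) ⟩
    α⇐ ∘ (f ⊗₁ (g ⊗₁ h)) ∘ α⇒ ∘ α⇐        ≡⟨ cong (α⇐ ∘_) (extendʳ (sym α-natural)) ⟩
    α⇐ ∘ α⇒ ∘ ((f ⊗₁ g) ⊗₁ h) ∘ α⇐        ≡⟨ pullˡ α-isoˡ ⟩
    id ∘ ((f ⊗₁ g) ⊗₁ h) ∘ α⇐             ≡⟨ identityˡ ⟩
    ((f ⊗₁ g) ⊗₁ h) ∘ α⇐                  ∎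

  ⟨_,_⟩ : Hom X Y → Hom X Z → Hom X (Y ⊗₀ Z)
  ⟨ f , g ⟩ = (f ⊗₁ g) ∘ copy

  ⊗∘⟨⟩ : {f : Hom X Y} {g : Hom X Z} {h : Hom Y Y′} {k : Hom Z Z′} →
         (h ⊗₁ k) ∘ ⟨ f , g ⟩ ≡ ⟨ h ∘ f , k ∘ g ⟩
  ⊗∘⟨⟩ = pullˡ (sym ⊗-∘)

  π₁ : Hom (X ⊗₀ Y) X
  π₁ = ρ⇒ ∘ (id ⊗₁ del)

  π₂ : Hom (X ⊗₀ Y) Y
  π₂ = λ⇒ ∘ (del ⊗₁ id)

  π₁∘⟨⟩ : {f : Hom X Y} {g : Hom X Z} → del ∘ g ≡ del → π₁ ∘ ⟨ f , g ⟩ ≡ f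
  π₁∘⟨⟩ {f = f} {g} del∘g = begin
    (ρ⇒ ∘ (id ⊗₁ del)) ∘ (f ⊗₁ g) ∘ copy   ≡⟨ assoc ⟩
    ρ⇒ ∘ (id ⊗₁ del) ∘ (f ⊗₁ g) ∘ copy     ≡⟨ cong (ρ⇒ ∘_) ⊗∘⟨⟩ ⟩
    ρ⇒ ∘ ((id ∘ f) ⊗₁ (del ∘ g)) ∘ copy    ≡⟨ cong (λ k → ρ⇒ ∘ k ∘ copy) (trans (cong₂ _⊗₁_ identityˡ del∘g) serialize₁₂) ⟩
    ρ⇒ ∘ ((f ⊗₁ id) ∘ (id ⊗₁ del)) ∘ copy  ≡⟨ cong (ρ⇒ ∘_) assoc ⟩
    ρ⇒ ∘ (f ⊗₁ id) ∘ (id ⊗₁ del) ∘ copy    ≡⟨ pullˡ ρ-natural ⟩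
    (f ∘ ρ⇒) ∘ (id ⊗₁ del) ∘ copy          ≡⟨ assoc ⟩
    f ∘ ρ⇒ ∘ (id ⊗₁ del) ∘ copy            ≡⟨ cong (f ∘_) copy-counitʳ ⟩
    f ∘ id                                 ≡⟨ identityʳ ⟩
    f                                      ∎

  π₂∘⟨⟩ : {f : Hom X Y} {g : Hom X Z} → del ∘ f ≡ del → π₂ ∘ ⟨ f , g ⟩ ≡ g
  π₂∘⟨⟩ {f = f} {g} del∘f = begin
    (λ⇒ ∘ (del ⊗₁ id)) ∘ (f ⊗₁ g) ∘ copy   ≡⟨ assoc ⟩
    λ⇒ ∘ (del ⊗₁ id) ∘ (f ⊗₁ g) ∘ copy     ≡⟨ cong (λ⇒ ∘_) ⊗∘⟨⟩ ⟩
    λ⇒ ∘ ((del ∘ f) ⊗₁ (id ∘ g)) ∘ copy    ≡⟨ cong (λ k → λ⇒ ∘ k ∘ copy) (trans (cong₂ _⊗₁_ del∘f identityˡ) serialize₂₁) ⟩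
    λ⇒ ∘ ((id ⊗₁ g) ∘ (del ⊗₁ id)) ∘ copy  ≡⟨ cong (λ⇒ ∘_) assoc ⟩
    λ⇒ ∘ (id ⊗₁ g) ∘ (del ⊗₁ id) ∘ copy    ≡⟨ pullˡ λ-natural ⟩
    (g ∘ λ⇒) ∘ (del ⊗₁ id) ∘ copy          ≡⟨ assoc ⟩
    g ∘ λ⇒ ∘ (del ⊗₁ id) ∘ copy            ≡⟨ cong (g ∘_) copy-counitˡ ⟩
    g ∘ id                                 ≡⟨ identityʳ ⟩
    g                                      ∎

  ρ⇒≡λ⇒ : ρ⇒ {unit} ≡ λ⇒
  ρ⇒≡λ⇒ = begin
    ρ⇒                  ≡⟨ sym identityʳ ⟩
    ρ⇒ ∘ id             ≡⟨ cong (ρ⇒ ∘_) (sym λ-isoˡ) ⟩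
    ρ⇒ ∘ λ⇐ ∘ λ⇒        ≡⟨ pullˡ ρ⇒∘λ⇐ ⟩
    id ∘ λ⇒             ≡⟨ identityˡ ⟩
    λ⇒                  ∎
    where
    ρ⇒∘λ⇐ : ρ⇒ ∘ λ⇐ ≡ id
    ρ⇒∘λ⇐ = begin
      ρ⇒ ∘ λ⇐                  ≡⟨ cong (ρ⇒ ∘_) (sym copy-unit) ⟩
      ρ⇒ ∘ copy                ≡⟨ cong (ρ⇒ ∘_) (sym identityˡ) ⟩
      ρ⇒ ∘ id ∘ copy           ≡⟨ cong (λ k → ρ⇒ ∘ k ∘ copy) (sym (trans (cong (id ⊗₁_) del-unit) ⊗-id)) ⟩
      ρ⇒ ∘ (id ⊗₁ del) ∘ copy  ≡⟨ copy-counitʳ ⟩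
      id                       ∎

  del∘π₁ : del ∘ π₁ {X} {Y} ≡ del
  del∘π₁ = begin
    del ∘ ρ⇒ ∘ (id ⊗₁ del)        ≡⟨ pullˡ (sym ρ-natural) ⟩
    (ρ⇒ ∘ (del ⊗₁ id)) ∘ (id ⊗₁ del) ≡⟨ trans assoc (cong (ρ⇒ ∘_) (sym serialize₁₂)) ⟩
    ρ⇒ ∘ (del ⊗₁ del)             ≡⟨ cong (_∘ (del ⊗₁ del)) ρ⇒≡λ⇒ ⟩
    λ⇒ ∘ (del ⊗₁ del)             ≡⟨ sym del-⊗ ⟩
    del                           ∎

  del∘π₂ : del ∘ π₂ {X} {Y} ≡ del
  del∘π₂ = begin
    del ∘ λ⇒ ∘ (del ⊗₁ id)        ≡⟨ pullˡ (sym λ-natural) ⟩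
    (λ⇒ ∘ (id ⊗₁ del)) ∘ (del ⊗₁ id) ≡⟨ trans assoc (cong (λ⇒ ∘_) (sym serialize₂₁)) ⟩
    λ⇒ ∘ (del ⊗₁ del)             ≡⟨ sym del-⊗ ⟩
    del                           ∎

  swap₁₂ : Hom (X ⊗₀ (Y ⊗₀ Z)) (Y ⊗₀ (X ⊗₀ Z))
  swap₁₂ = α⇒ ∘ (σ ⊗₁ id) ∘ α⇐

  interchange : Hom ((X ⊗₀ Y) ⊗₀ (Z ⊗₀ W)) ((X ⊗₀ Z) ⊗₀ (Y ⊗₀ W))
  interchange = α⇐ ∘ (id ⊗₁ swap₁₂) ∘ α⇒

  swap₁₂-natural : {f : Hom X X′} {g : Hom Y Y′} {h : Hom Z Z′} →
                   swap₁₂ ∘ (f ⊗₁ (g ⊗₁ h)) ≡ (g ⊗₁ (f ⊗₁ h)) ∘ swap₁₂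
  swap₁₂-natural {f = f} {g} {h} = begin
    (α⇒ ∘ (σ ⊗₁ id) ∘ α⇐) ∘ (f ⊗₁ (g ⊗₁ h))  ≡⟨ trans assoc (cong (α⇒ ∘_) assoc) ⟩
    α⇒ ∘ (σ ⊗₁ id) ∘ α⇐ ∘ (f ⊗₁ (g ⊗₁ h))    ≡⟨ cong (λ k → α⇒ ∘ (σ ⊗₁ id) ∘ k) α⇐-natural ⟩
    α⇒ ∘ (σ ⊗₁ id) ∘ ((f ⊗₁ g) ⊗₁ h) ∘ α⇐    ≡⟨ cong (α⇒ ∘_) (extendʳ σ⊗id-natural) ⟩
    α⇒ ∘ ((g ⊗₁ f) ⊗₁ h) ∘ (σ ⊗₁ id) ∘ α⇐    ≡⟨ extendʳ α-natural ⟩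
    (g ⊗₁ (f ⊗₁ h)) ∘ α⇒ ∘ (σ ⊗₁ id) ∘ α⇐    ∎
    where
    σ⊗id-natural : (σ ⊗₁ id) ∘ ((f ⊗₁ g) ⊗₁ h) ≡ ((g ⊗₁ f) ⊗₁ h) ∘ (σ ⊗₁ id)
    σ⊗id-natural = trans (sym ⊗-∘) (trans (cong₂ _⊗₁_ σ-natural (trans identityˡ (sym identityʳ))) ⊗-∘)

  interchange-natural : {f : Hom X X′} {g : Hom Y Y′} {h : Hom Z Z′} {k : Hom W W′} →
                        interchange ∘ ((f ⊗₁ g) ⊗₁ (h ⊗₁ k)) ≡ ((f ⊗₁ h) ⊗₁ (g ⊗₁ k)) ∘ interchange
  interchange-natural {f = f} {g} {h} {k} = begin
    (α⇐ ∘ (id ⊗₁ swap₁₂) ∘ α⇒) ∘ ((f ⊗₁ g) ⊗₁ (h ⊗₁ k))  ≡⟨ trans assoc (cong (α⇐ ∘_) assoc) ⟩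
    α⇐ ∘ (id ⊗₁ swap₁₂) ∘ α⇒ ∘ ((f ⊗₁ g) ⊗₁ (h ⊗₁ k))    ≡⟨ cong (λ l → α⇐ ∘ (id ⊗₁ swap₁₂) ∘ l) α-natural ⟩
    α⇐ ∘ (id ⊗₁ swap₁₂) ∘ (f ⊗₁ (g ⊗₁ (h ⊗₁ k))) ∘ α⇒    ≡⟨ cong (α⇐ ∘_) (extendʳ id⊗swap₁₂-natural) ⟩
    α⇐ ∘ (f ⊗₁ (h ⊗₁ (g ⊗₁ k))) ∘ (id ⊗₁ swap₁₂) ∘ α⇒    ≡⟨ extendʳ α⇐-natural ⟩
    ((f ⊗₁ h) ⊗₁ (g ⊗₁ k)) ∘ α⇐ ∘ (id ⊗₁ swap₁₂) ∘ α⇒    ∎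
    where
    id⊗swap₁₂-natural : (id ⊗₁ swap₁₂) ∘ (f ⊗₁ (g ⊗₁ (h ⊗₁ k))) ≡ (f ⊗₁ (h ⊗₁ (g ⊗₁ k))) ∘ (id ⊗₁ swap₁₂)
    id⊗swap₁₂-natural = trans (sym ⊗-∘) (trans (cong₂ _⊗₁_ (trans identityˡ (sym identityʳ)) swap₁₂-natural) ⊗-∘)

  id-functional : Functional (id {X})
  id-functional = trans identityʳ (trans (sym identityˡ) (cong (_∘ copy) (sym ⊗-id)))

  ∘-functional : {f : Hom X Y} {g : Hom Y Z} → Functional f → Functional g → Functional (g ∘ f)
  ∘-functional {f = f} {g} f-fun g-fun = begin
    copy ∘ g ∘ f                ≡⟨ pullˡ g-fun ⟩
    ((g ⊗₁ g) ∘ copy) ∘ f       ≡⟨ trans assoc (cong ((g ⊗₁ g) ∘_) f-fun) ⟩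
    (g ⊗₁ g) ∘ (f ⊗₁ f) ∘ copy  ≡⟨ ⊗∘⟨⟩ ⟩
    ((g ∘ f) ⊗₁ (g ∘ f)) ∘ copy ∎

  ⊗-functional : {f : Hom X X′} {g : Hom Y Y′} → Functional f → Functional g → Functional (f ⊗₁ g)
  ⊗-functional {f = f} {g} f-fun g-fun = begin
    copy ∘ (f ⊗₁ g)                                  ≡⟨ trans (cong (_∘ (f ⊗₁ g)) copy-⊗) assoc ⟩
    interchange ∘ (copy ⊗₁ copy) ∘ (f ⊗₁ g)          ≡⟨ cong (interchange ∘_) (sym ⊗-∘) ⟩
    interchange ∘ ((copy ∘ f) ⊗₁ (copy ∘ g))         ≡⟨ cong (λ h → interchange ∘ h) (trans (cong₂ _⊗₁_ f-fun g-fun) ⊗-∘) ⟩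
    interchange ∘ ((f ⊗₁ f) ⊗₁ (g ⊗₁ g)) ∘ (copy ⊗₁ copy) ≡⟨ extendʳ interchange-natural ⟩
    ((f ⊗₁ g) ⊗₁ (f ⊗₁ g)) ∘ interchange ∘ (copy ⊗₁ copy) ≡⟨ cong (((f ⊗₁ g) ⊗₁ (f ⊗₁ g)) ∘_) (sym copy-⊗) ⟩
    ((f ⊗₁ g) ⊗₁ (f ⊗₁ g)) ∘ copy                    ∎

  copy₃ : Hom X (X ⊗₀ (X ⊗₀ X))
  copy₃ = (id ⊗₁ copy) ∘ copy

  copy⊗copy∘copy : (copy ⊗₁ copy) ∘ copy {X} ≡ α⇐ ∘ (id ⊗₁ copy₃) ∘ copy
  copy⊗copy∘copy {X} = begin
    (copy ⊗₁ copy) ∘ copy                                 ≡⟨ sym identityˡ ⟩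
    id ∘ (copy ⊗₁ copy) ∘ copy                            ≡⟨ trans (cong (_∘ _) (sym α-isoˡ)) assoc ⟩
    α⇐ ∘ α⇒ ∘ (copy ⊗₁ copy) ∘ copy                       ≡⟨ cong (λ h → α⇐ ∘ α⇒ ∘ h) (trans (cong (_∘ copy) copy⊗copy) assoc) ⟩
    α⇐ ∘ α⇒ ∘ ((id ⊗₁ id) ⊗₁ copy) ∘ (copy ⊗₁ id) ∘ copy  ≡⟨ cong (α⇐ ∘_) (extendʳ α-natural) ⟩
    α⇐ ∘ (id ⊗₁ (id ⊗₁ copy)) ∘ α⇒ ∘ (copy ⊗₁ id) ∘ copy  ≡⟨ cong (λ h → α⇐ ∘ (id ⊗₁ (id ⊗₁ copy)) ∘ h) copy-coassoc ⟩
    α⇐ ∘ (id ⊗₁ (id ⊗₁ copy)) ∘ (id ⊗₁ copy) ∘ copy       ≡⟨ cong (α⇐ ∘_) (pullˡ (trans (sym ⊗-∘) (cong (_⊗₁ copy₃) identityˡ))) ⟩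
    α⇐ ∘ (id ⊗₁ copy₃) ∘ copy                             ∎
    where
    copy⊗copy : copy ⊗₁ copy ≡ ((id ⊗₁ id) ⊗₁ copy) ∘ (copy ⊗₁ id {X})
    copy⊗copy = trans serialize₂₁ (cong (λ h → (h ⊗₁ copy) ∘ (copy ⊗₁ id)) (sym ⊗-id))

  swap₁₂∘copy₃ : swap₁₂ ∘ copy₃ {X} ≡ copy₃
  swap₁₂∘copy₃ = begin
    (α⇒ ∘ (σ ⊗₁ id) ∘ α⇐) ∘ (id ⊗₁ copy) ∘ copy  ≡⟨ trans assoc (cong (α⇒ ∘_) assoc) ⟩
    α⇒ ∘ (σ ⊗₁ id) ∘ α⇐ ∘ (id ⊗₁ copy) ∘ copy    ≡⟨ cong (λ h → α⇒ ∘ (σ ⊗₁ id) ∘ h) (trans (cong (α⇐ ∘_) (sym copy-coassoc)) (trans (pullˡ α-isoˡ) identityˡ)) ⟩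
    α⇒ ∘ (σ ⊗₁ id) ∘ (copy ⊗₁ id) ∘ copy         ≡⟨ cong (α⇒ ∘_) (pullˡ (trans (sym ⊗-∘) (cong₂ _⊗₁_ copy-comm identityˡ))) ⟩
    α⇒ ∘ (copy ⊗₁ id) ∘ copy                     ≡⟨ copy-coassoc ⟩
    copy₃                                        ∎

  copy-functional : Functional (copy {X})
  copy-functional = begin
    copy ∘ copy                                                  ≡⟨ trans (cong (_∘ copy) copy-⊗) assoc ⟩
    interchange ∘ (copy ⊗₁ copy) ∘ copy                          ≡⟨ cong (interchange ∘_) copy⊗copy∘copy ⟩
    (α⇐ ∘ (id ⊗₁ swap₁₂) ∘ α⇒) ∘ α⇐ ∘ (id ⊗₁ copy₃) ∘ copy       ≡⟨ trans assoc (cong (α⇐ ∘_) assoc) ⟩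
    α⇐ ∘ (id ⊗₁ swap₁₂) ∘ α⇒ ∘ α⇐ ∘ (id ⊗₁ copy₃) ∘ copy         ≡⟨ cong (λ h → α⇐ ∘ (id ⊗₁ swap₁₂) ∘ h) (trans (pullˡ α-isoʳ) identityˡ) ⟩
    α⇐ ∘ (id ⊗₁ swap₁₂) ∘ (id ⊗₁ copy₃) ∘ copy                   ≡⟨ cong (α⇐ ∘_) (pullˡ (trans (sym ⊗-∘) (cong₂ _⊗₁_ identityˡ swap₁₂∘copy₃))) ⟩
    α⇐ ∘ (id ⊗₁ copy₃) ∘ copy                                    ≡⟨ sym copy⊗copy∘copy ⟩
    (copy ⊗₁ copy) ∘ copy                                        ∎

  ⟨⟩-functional : {f : Hom X Y} {g : Hom X Z} → Functional f → Functional g → Functional ⟨ f , g ⟩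
  ⟨⟩-functional f-fun g-fun = ∘-functional copy-functional (⊗-functional f-fun g-fun)

module LaxGSFunctorProperties {o ℓ p : Level} {𝒞 : GSMonCat o ℓ} (Φ : LaxGSFunctor 𝒞 p) where
  open GSMonCat 𝒞
  open LaxGSFunctor Φ
  open GSMonoidalProperties 𝒞

  private variable
    X Y Z : Obj

  F-cong : {f g : Hom X Y} → f ≡ g → F₁ f ≐ F₁ g
  F-cong refl = ≐-refl

  F-∘-cong : {f : Hom X Y} {g : Hom Y Z} {h : Hom X Z} → g ∘ f ≡ h → (F₁ g ∘R F₁ f) ≐ F₁ h
  F-∘-cong e = ≐-trans (≐-sym F-∘) (F-cong e)

  F-copy⇒ψ : ∀ {x w} → F₁ (copy {X}) x w → ψ (x , x) w
  F-copy⇒ψ c with ≐⇒ F-copy c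
  ... | _ , refl , ψw = ψw

  ψ⇒F-copy : ∀ {x w} → ψ (x , x) w → F₁ (copy {X}) x w
  ψ⇒F-copy ψw = ≐⇐ F-copy (_ , refl , ψw)

  F-⟨⟩⇒ : {f : Hom X Y} {g : Hom X Z} → ∀ {x w} → F₁ ⟨ f , g ⟩ x w →
          Σ[ y ∈ F₀ Y ] Σ[ z ∈ F₀ Z ] (F₁ f x y × F₁ g x z × ψ (y , z) w)
  F-⟨⟩⇒ {f = f} {g} fgw with ≐⇒ F-∘ fgw
  ... | v , copy-v , fg-w with ≐⇒ (ψ-natural {f = f} {g = g}) (v , F-copy⇒ψ copy-v , fg-w)
  ... | (y , z) , (fy , gz) , ψw = y , z , fy , gz , ψw

  ⇒F-⟨⟩ : {f : Hom X Y} {g : Hom X Z} → ∀ {x y z w} →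
          F₁ f x y → F₁ g x z → ψ (y , z) w → F₁ ⟨ f , g ⟩ x w
  ⇒F-⟨⟩ {f = f} {g} fy gz ψw with ≐⇐ (ψ-natural {f = f} {g = g}) (_ , (fy , gz) , ψw)
  ... | v , ψv , fg-w = ≐⇐ F-∘ (v , ψ⇒F-copy ψv , fg-w)

  F-total-section : {h : Hom X Y} {r : Hom Y X} → r ∘ h ≡ id → Total (F₁ h)
  F-total-section {h = h} r∘h x with ≐⇒ F-∘ (subst (λ k → F₁ k x x) (sym r∘h) (≐⇐ F-id refl))
  ... | y , hy , _ = y , hy

  π₁-total : Total (F₁ (π₁ {X} {Y}))
  π₁-total w with F-⟨⟩⇒ (proj₂ (F-total-section (π₂∘⟨⟩ del∘π₁) w))
  ... | x , _ , π₁x , _ = x , π₁x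

  π₂-total : Total (F₁ (π₂ {X} {Y}))
  π₂-total w with F-⟨⟩⇒ (proj₂ (F-total-section (π₁∘⟨⟩ del∘π₂) w))
  ... | _ , y , _ , π₂y , _ = y , π₂y

  π₁-ψ : ∀ {x : F₀ X} {y : F₀ Y} {w u} → ψ (x , y) w → F₁ π₁ w u → u ≡ x
  π₁-ψ ψw π₁u with ≐⇒ F-∘ π₁u
  ... | v , id⊗del-v , ρu with ≐⇒ (ψ-natural {f = id} {g = del}) (_ , ψw , id⊗del-v)
  ... | (x′ , t) , (x≡x′ , del-t) , ψv with ≐⇒ F-id x≡x′ | ≐⇒ F-del del-t
  ... | refl | _ , refl , ψ₀t = sym (≐⇒ ψ-unitʳ (v , ((_ , t) , (refl , ψ₀t) , ψv) , ρu))

  π₂-ψ : ∀ {x : F₀ X} {y : F₀ Y} {w u} → ψ (x , y) w → F₁ π₂ w u → u ≡ y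
  π₂-ψ ψw π₂u with ≐⇒ F-∘ π₂u
  ... | v , del⊗id-v , λu with ≐⇒ (ψ-natural {f = del} {g = id}) (_ , ψw , del⊗id-v)
  ... | (t , y′) , (del-t , y≡y′) , ψv with ≐⇒ F-id y≡y′ | ≐⇒ F-del del-t
  ... | refl | _ , refl , ψ₀t = sym (≐⇒ ψ-unitˡ (v , ((t , _) , (ψ₀t , refl) , ψv) , λu))

  ψ-total : (x : F₀ X) (y : F₀ Y) → Σ _ (ψ (x , y))
  ψ-total x y with ≐⇐ ψ-unitʳ {x , tt} refl
  ... | v , ((x′ , t) , (x≡x′ , ψ₀t) , ψv) , _
    with ≐⇐ (ψ-natural {f = id} {g = del})
            (_ , (≐⇐ F-id x≡x′ , ≐⇐ F-del (tt , refl , ψ₀t)) , ψv)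
  ... | w , ψw , _ = w , ψw

  ψ-injective : ∀ {x x′ : F₀ X} {y y′ : F₀ Y} {w} → ψ (x , y) w → ψ (x′ , y′) w → x ≡ x′ × y ≡ y′
  ψ-injective {w = w} ψw ψ′w with π₁-total w | π₂-total w
  ... | u , π₁u | v , π₂v =
    trans (sym (π₁-ψ ψw π₁u)) (π₁-ψ ψ′w π₁u) , trans (sym (π₂-ψ ψw π₂v)) (π₂-ψ ψ′w π₂v)

  -- Pair the two values y₁, y₂ by ψ; functionality rewrites that pair as
  -- the image of a diagonal (y , y), and ψ is injective.
  Functional⇒SingleValued : {h : Hom X Y} → Functional h → SingleValued (F₁ h)
  Functional⇒SingleValued {h = h} h-fun {x} {y₁} {y₂} hy₁ hy₂ =
    trans (proj₁ y₁,y₂≡y,y) (sym (proj₂ y₁,y₂≡y,y))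
    where
    w : F₀ _
    w = proj₁ (ψ-total y₁ y₂)

    ψw : ψ (y₁ , y₂) w
    ψw = proj₂ (ψ-total y₁ y₂)

    copy∘h-w : (F₁ copy ∘R F₁ h) x w
    copy∘h-w = ≐⇒ F-∘ (subst (λ k → F₁ k x w) (sym h-fun) (⇒F-⟨⟩ hy₁ hy₂ ψw))

    y₁,y₂≡y,y : y₁ ≡ proj₁ copy∘h-w × y₂ ≡ proj₁ copy∘h-w
    y₁,y₂≡y,y = ψ-injective ψw (F-copy⇒ψ (proj₂ (proj₂ copy∘h-w)))

module QuasiFixedPoints {o ℓ p : Level} (𝕋 : TCCat o ℓ p) where
  open TCCat 𝕋
  open GSMonoidalProperties 𝒞
  open LaxGSFunctorProperties Φ
  open ImitationProperties _⪰B_ (IsPreorder.trans ⪰B-preorder)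
  open ≡-Reasoning

  selfApply : Hom (C ⊗₀ C) (T ⊗₀ C) → Hom C B
  selfApply s = eval ∘ s ∘ copy

  diagonal : ∀ {A} → Hom (C ⊗₀ C) (T ⊗₀ C) → Hom B B → Hom (A ⊗₀ C) B
  diagonal s g = g ∘ selfApply s ∘ π₂

  selfApply-imitates : ∀ {A} {s : Hom (C ⊗₀ C) (T ⊗₀ C)} {r : Hom T C} {p : Hom A T} →
    (s ∘ (r ⊗₁ id)) ⪰ id → Functional (r ∘ p) →
    Imitates _⪰B_ (F₁ (selfApply s ∘ r ∘ p)) (F₁ (eval ∘ (p ⊗₁ id) ∘ ⟨ id , r ∘ p ⟩))
  selfApply-imitates {s = s} {r} {p} s∘r⪰id q-functional =
    Imitates-resp-≐ (F-∘-cong simulate) (F-∘-cong (cong (eval ∘_) identityˡ))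
                    (⪰-precomp ((p ⊗₁ id) ∘ ⟨ id , r ∘ p ⟩) s∘r⪰id)
    where
    simulate : eval ∘ (s ∘ (r ⊗₁ id)) ∘ (p ⊗₁ id) ∘ ⟨ id , r ∘ p ⟩ ≡ selfApply s ∘ r ∘ p
    simulate = begin
      eval ∘ (s ∘ (r ⊗₁ id)) ∘ (p ⊗₁ id) ∘ ⟨ id , r ∘ p ⟩  ≡⟨ cong (eval ∘_) (trans assoc (cong (λ k → s ∘ (r ⊗₁ id) ∘ k) ⊗∘⟨⟩)) ⟩
      eval ∘ s ∘ (r ⊗₁ id) ∘ ⟨ p ∘ id , id ∘ r ∘ p ⟩        ≡⟨ cong (λ k → eval ∘ s ∘ k) ⊗∘⟨⟩ ⟩
      eval ∘ s ∘ ⟨ r ∘ p ∘ id , id ∘ id ∘ r ∘ p ⟩           ≡⟨ cong (λ k → eval ∘ s ∘ k) (cong₂ ⟨_,_⟩ (cong (r ∘_) identityʳ) (trans identityˡ identityˡ)) ⟩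
      eval ∘ s ∘ ⟨ r ∘ p , r ∘ p ⟩                          ≡⟨ cong (λ k → eval ∘ s ∘ k) (sym q-functional) ⟩
      eval ∘ s ∘ copy ∘ r ∘ p                               ≡⟨ sym (trans assoc (cong (eval ∘_) assoc)) ⟩
      (eval ∘ s ∘ copy) ∘ r ∘ p                             ∎

  diagonal-imitates : ∀ {A} {s : Hom (C ⊗₀ C) (T ⊗₀ C)} {g : Hom B B} {p : Hom A T} {q : Hom A C} →
    Functional q → Imitates _⪰B_ (F₁ (eval ∘ (p ⊗₁ id))) (F₁ (diagonal s g)) →
    Imitates _⪰B_ (F₁ (eval ∘ (p ⊗₁ id) ∘ ⟨ id , q ⟩)) (F₁ g ∘R F₁ (selfApply s ∘ q))
  diagonal-imitates {s = s} {g} {q = q} q-functional eval∘p⪰diagonal =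
    Imitates-resp-≐ (F-∘-cong assoc) (≐-trans (F-∘-cong diagonal∘⟨id,q⟩) F-∘)
      (Imitates-∘R (Functional⇒SingleValued (⟨⟩-functional id-functional q-functional)) eval∘p⪰diagonal)
    where
    diagonal∘⟨id,q⟩ : diagonal s g ∘ ⟨ id , q ⟩ ≡ g ∘ selfApply s ∘ q
    diagonal∘⟨id,q⟩ = begin
      (g ∘ selfApply s ∘ π₂) ∘ ⟨ id , q ⟩  ≡⟨ trans assoc (cong (g ∘_) assoc) ⟩
      g ∘ selfApply s ∘ π₂ ∘ ⟨ id , q ⟩    ≡⟨ cong (λ k → g ∘ selfApply s ∘ k) (π₂∘⟨⟩ identityʳ) ⟩
      g ∘ selfApply s ∘ q                  ∎

mainTheorem7 : ∀ {o ℓ p : Level} (𝕋 : TCCat o ℓ p) → let open TCCat 𝕋 in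
    (A : Obj) → IsCompleteParametrization A eval →
    (s : Hom (C ⊗₀ C) (T ⊗₀ C)) → IsUniversalSimulator s →
    (g : Hom B B) → Σ[ X ∈ Obj ] Σ[ b ∈ Hom X B ] QuasiFixedPoint g b
mainTheorem7 𝕋 A complete s (_ , r , r-functional , s∘r⪰id) g =
  A , selfApply s ∘ r ∘ p ,
  Imitates-trans (selfApply-imitates s∘r⪰id q-functional) (diagonal-imitates q-functional eval∘p⪰diagonal)
  where
  open TCCat 𝕋
  open GSMonoidalProperties 𝒞 using (∘-functional)
  open ImitationProperties _⪰B_ (IsPreorder.trans ⪰B-preorder) using (Imitates-trans)
  open QuasiFixedPoints 𝕋

  p : Hom A T
  p = proj₁ (complete (diagonal s g))

  q-functional : Functional (r ∘ p)
  q-functional = ∘-functional (proj₁ (proj₂ (complete (diagonal s g)))) r-functional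

  eval∘p⪰diagonal : Imitates _⪰B_ (F₁ (eval ∘ (p ⊗₁ id))) (F₁ (diagonal s g))
  eval∘p⪰diagonal = proj₂ (proj₂ (complete (diagonal s g)))
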